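{- Let $G$ be a finite simple graph. A subset $D\subseteq V(\overline{\mu(G)})$ is an exact doubly dominating set of the complement $\overline{\mu(G)}$ of the Mycielski graph of $G$ if and only if $D$ consists of exactly two isolated vertices of $G$. In particular, $\overline{\mu(G)}$ has an exact doubly dominating set if and only if $G$ has at least two isolated vertices.
   Context: For a vertex $v$ of a graph $X$, $N_X[v]$ denotes its closed neighborhood. An exact doubly dominating set of $X$ is a subset $D\subseteq V(X)$ with $|N_X[v]\cap D|=2$ for every $v\in V(X)$. For a graph $G$ with $V(G)=\{v_1,\dots,v_n\}$, the Mycielski graph $\mu(G)$ has vertex set $V(G)\cup\{w,u_1,\dots,u_n\}$ and edge set $E(G)\cup\{v_iu_j: v_iv_j\in E(G)\}\cup\{wu_i: 1\le i\le n\}$. $\overline{X}$ denotes the complement graph of $X$. An isolated vertex is a vertex of degree zero. -}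

module Defs where

open import Data.Nat using (ℕ)
open import Data.Bool using (Bool; true; false; _∧_; _∨_; not)
open import Data.Fin using (Fin)
open import Data.Fin.Properties using (_≟_)
open import Data.List using (List; _∷_; []; map; _++_; filterᵇ; length; allFin)
open import Data.Product using (Σ; _×_; ∃-syntax)
open import Data.Sum using (_⊎_)
open import Relation.Nullary using (¬_; does)
open import Relation.Binary.PropositionalEquality using (_≡_)
open import Function.Bundles using (_⇔_)

record Graph (n : ℕ) : Set where
  field
    adj    : Fin n → Fin n → Bool
    sym    : ∀ i j → adj i j ≡ adj j i
    irrefl : ∀ i → adj i i ≡ false
open Graph public

-- Vertices of the Mycielski graph μ(G): v_i, u_i, and w.
data MV (n : ℕ) : Set where
  vtx    : Fin n → MV n
  shadow : Fin n → MV n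
  w      : MV n

allMV : (n : ℕ) → List (MV n)
allMV n = map vtx (allFin n) ++ map shadow (allFin n) ++ (w ∷ [])

_==MV_ : ∀ {n} → MV n → MV n → Bool
vtx i    ==MV vtx j    = does (i ≟ j)
shadow i ==MV shadow j = does (i ≟ j)
w        ==MV w        = true
_        ==MV _        = false

-- Adjacency in μ(G):  E(G) ∪ {v_i u_j : v_i v_j ∈ E(G)} ∪ {w u_i}
muAdj : ∀ {n} → Graph n → MV n → MV n → Bool
muAdj G (vtx i)    (vtx j)    = adj G i j
muAdj G (vtx i)    (shadow j) = adj G i j
muAdj G (shadow j) (vtx i)    = adj G i j
muAdj G (shadow _) w          = true
muAdj G w          (shadow _) = true
muAdj G _          _          = false

coMuAdj : ∀ {n} → Graph n → MV n → MV n → Bool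
coMuAdj G x y = not (x ==MV y) ∧ not (muAdj G x y)

closedNbhd : ∀ {n} → Graph n → MV n → MV n → Bool
closedNbhd G x y = (x ==MV y) ∨ coMuAdj G x y

nbhdCount : ∀ {n} → Graph n → (MV n → Bool) → MV n → ℕ
nbhdCount {n} G D x = length (filterᵇ (λ y → closedNbhd G x y ∧ D y) (allMV n))

IsEDDComplMu : ∀ {n} → Graph n → (MV n → Bool) → Set
IsEDDComplMu G D = ∀ x → nbhdCount G D x ≡ 2

Isolated : ∀ {n} → Graph n → Fin n → Set
Isolated G i = ∀ j → adj G i j ≡ false

TwoIsolated : ∀ {n} → Graph n → (MV n → Bool) → Set
TwoIsolated {n} G D =
  ∃[ i ] ∃[ j ] (¬ i ≡ j × Isolated G i × Isolated G j ×
    (∀ x → (D x ≡ true) ⇔ (x ≡ vtx i ⊎ x ≡ vtx j)))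

-- In the complement of μ(G) the closed neighbourhoods are N[w] = {v_j} ∪ {w},
-- N[u_i] = {v_j : v_j ≁ v_i} ∪ {u_j}, and N[v_i] = {v_j : v_j ≁ v_i} ∪ {u_j : v_j ≁ v_i} ∪ {w}.
-- Comparing the counts at v_i and u_i shows that every v_i is adjacent in G to exactly
-- [w ∈ D] of the u_j in D. If w ∈ D, then D contains a single v_a and some u_b with v_b ~ v_a,
-- and the counts at u_a and u_b cannot both be 2. So w ∉ D; then every u_j ∈ D is isolated,
-- which overfills N[u_j]; so D consists of two vertices v_a, v_b, and the count 2 at every u_i
-- says that no v_i is adjacent to v_a or v_b.

module Submission where

open import Defs renaming (sym to adj-sym)
open import Data.Nat using (ℕ; zero; suc; pred; _+_; _≤_; _<_; z≤n; s≤s)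
open import Data.Nat.Properties
  using (+-identityʳ; +-suc; +-comm; +-cancelˡ-≡; +-cancelʳ-≡; +-mono-≤; ≤-refl; ≤-reflexive; <-irrefl; n<1⇒n≡0; 1+n≰n; m<n⇒n≢0)
open import Data.Bool using (Bool; true; false; _∧_; not)
open import Data.Bool.Properties using (∧-zeroʳ; ∧-identityʳ; ¬-not; not-¬)
open import Data.Fin using (Fin; zero; suc)
open import Data.Fin.Properties using (_≟_)
open import Data.List using (List; _∷_; []; map; _++_; filterᵇ; length; tabulate; allFin)
open import Data.List.Properties using (length-++; filter-++; map-tabulate)
open import Data.Product using (_×_; ∃; ∃-syntax; _,_; proj₁; proj₂)
open import Data.Sum using (_⊎_; inj₁; inj₂; [_,_])
import Data.Sum
open import Data.Empty using (⊥)
open import Relation.Nullary using (¬_; Dec; yes; no; does; contradiction)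
open import Relation.Nullary.Decidable using (dec-true; dec-false; T?; _⊎-dec_)
open import Relation.Binary.PropositionalEquality
  using (_≡_; _≢_; refl; sym; trans; cong; cong₂; subst; module ≡-Reasoning)
open import Function using (_∘_)
open import Function.Bundles using (_⇔_; mk⇔; Equivalence)

toℕ : Bool → ℕ
toℕ false = 0
toℕ true  = 1

does≡true⇔ : ∀ {a} {A : Set a} (a? : Dec A) → does a? ≡ true ⇔ A
does≡true⇔ (yes a) = mk⇔ (λ _ → a) (λ _ → refl)
does≡true⇔ (no ¬a) = mk⇔ (λ ()) (λ a → contradiction a ¬a)

∧-true⁻ : ∀ {x y} → x ∧ y ≡ true → x ≡ true × y ≡ true
∧-true⁻ {true} {true} _ = refl , refl

∧-falseˡ : ∀ {x y} → x ∧ y ≡ false → y ≡ true → x ≡ false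
∧-falseˡ {x} e refl = trans (sym (∧-identityʳ x)) e

count : ∀ {n} → (Fin n → Bool) → ℕ
count {zero}  p = 0
count {suc n} p = toℕ (p zero) + count (p ∘ suc)

infix 4 _⊆_
_⊆_ : ∀ {n} → (Fin n → Bool) → (Fin n → Bool) → Set
p ⊆ q = ∀ i → p i ≡ true → q i ≡ true

count-cong : ∀ {n} {p q : Fin n → Bool} → (∀ i → p i ≡ q i) → count p ≡ count q
count-cong {zero}  eq = refl
count-cong {suc n} eq = cong₂ _+_ (cong toℕ (eq zero)) (count-cong (eq ∘ suc))

count-none : ∀ {n} {p : Fin n → Bool} → (∀ i → p i ≡ false) → count p ≡ 0
count-none {zero}          _    = refl
count-none {suc n} {p} none rewrite none zero = count-none (none ∘ suc)

count-witness : ∀ {n} {p : Fin n → Bool} → 0 < count p → ∃ λ i → p i ≡ true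
count-witness {suc n} {p} pos with p zero in eq
... | true  = zero , eq
... | false with i , pi ← count-witness pos = suc i , pi

count-mono : ∀ {n} {p q : Fin n → Bool} → p ⊆ q → count p ≤ count q
count-mono {zero}          _   = z≤n
count-mono {suc n} {p} {q} p⊆q = +-mono-≤ head (count-mono (p⊆q ∘ suc))
  where
  head : toℕ (p zero) ≤ toℕ (q zero)
  head with p zero in eq
  ... | false = z≤n
  ... | true  rewrite p⊆q zero eq = ≤-refl

count-split : ∀ {n} (q p : Fin n → Bool) →
  count p ≡ count (λ j → q j ∧ p j) + count (λ j → not (q j) ∧ p j)
count-split {zero}  q p = refl
count-split {suc n} q p with q zero | p zero | count-split (q ∘ suc) (p ∘ suc)
... | true  | true  | ih = cong suc ih
... | true  | false | ih = ih
... | false | true  | ih = trans (cong suc ih) (sym (+-suc _ _))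
... | false | false | ih = ih

count-at : ∀ {n} (a : Fin n) (p : Fin n → Bool) → count (λ j → does (j ≟ a) ∧ p j) ≡ toℕ (p a)
count-at {suc n} zero    p =
  trans (cong (toℕ (p zero) +_) (count-none {p = λ j → does (suc j ≟ zero) ∧ p (suc j)} (λ _ → refl)))
        (+-identityʳ _)
count-at {suc n} (suc a) p = count-at a (p ∘ suc)

without : ∀ {n} → Fin n → (Fin n → Bool) → Fin n → Bool
without a p j = not (does (j ≟ a)) ∧ p j

without-⊆ : ∀ {n} {a : Fin n} {p} → without a p ⊆ p
without-⊆ {a = a} j wj with does (j ≟ a)
... | true  = contradiction wj λ ()
... | false = wj

without-mono : ∀ {n} {a : Fin n} {p q} → p ⊆ q → without a p ⊆ without a q
without-mono {a = a} p⊆q j wj with does (j ≟ a)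
... | true  = wj
... | false = p⊆q j wj

without-self : ∀ {n} (p : Fin n → Bool) a → without a p a ≡ false
without-self p a rewrite dec-true (a ≟ a) refl = refl

without-other : ∀ {n} (p : Fin n → Bool) {a j} → j ≢ a → without a p j ≡ p j
without-other p {a} {j} j≢a rewrite dec-false (j ≟ a) j≢a = refl

count-without : ∀ {n} (p : Fin n → Bool) a → count p ≡ toℕ (p a) + count (without a p)
count-without p a = trans (count-split (λ j → does (j ≟ a)) p) (cong (_+ count (without a p)) (count-at a p))

count-without-true : ∀ {n} (p : Fin n → Bool) {a} → p a ≡ true → count p ≡ suc (count (without a p))
count-without-true p {a} pa = trans (count-without p a) (cong (λ x → toℕ x + count (without a p)) pa)

count-pos : ∀ {n} (p : Fin n → Bool) {a} → p a ≡ true → 0 < count p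
count-pos p pa rewrite count-without-true p pa = s≤s z≤n

count≡0⇒false : ∀ {n} (p : Fin n → Bool) → count p ≡ 0 → ∀ i → p i ≡ false
count≡0⇒false p c i = ¬-not λ pi → m<n⇒n≢0 (count-pos p pi) c

count-< : ∀ {n} {p q : Fin n → Bool} {b} → p ⊆ q → p b ≡ false → q b ≡ true → count p < count q
count-< {p = p} {q} {b} p⊆q pb qb
  rewrite count-without p b | count-without q b | pb | qb = s≤s (count-mono (without-mono p⊆q))

count-single : ∀ {n} (p : Fin n → Bool) {a} → p a ≡ true → (∀ j → p j ≡ true → j ≡ a) → count p ≡ 1
count-single p {a} pa onlyA = trans (count-without-true p pa) (cong suc (count-none outside))
  where
  outside : ∀ j → without a p j ≡ false
  outside j with j ≟ a
  ... | yes _   = refl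
  ... | no  j≢a = ¬-not (j≢a ∘ onlyA j)

count≡1 : ∀ {n} (p : Fin n → Bool) → count p ≡ 1 → ∃[ a ] (p a ≡ true × (∀ j → p j ≡ true → j ≡ a))
count≡1 p c with a , pa ← count-witness {p = p} (subst (0 <_) (sym c) (s≤s z≤n)) = a , pa , onlyA a pa
  where
  onlyA : ∀ a → p a ≡ true → ∀ j → p j ≡ true → j ≡ a
  onlyA a pa j pj with j ≟ a
  ... | yes j≡a = j≡a
  ... | no  j≢a = contradiction (trans (sym pj) (trans (sym (without-other p j≢a)) (count≡0⇒false _ rest j))) λ ()
    where
    rest : count (without a p) ≡ 0
    rest = cong pred (trans (sym (count-without-true p pa)) c)

count≡2 : ∀ {n} (p : Fin n → Bool) → count p ≡ 2 →
  ∃[ a ] ∃[ b ] (a ≢ b × p a ≡ true × p b ≡ true × (∀ j → p j ≡ true → j ≡ a ⊎ j ≡ b))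
count≡2 p c with a , pa ← count-witness {p = p} (subst (0 <_) (sym c) (s≤s z≤n)) = a , second a pa
  where
  second : ∀ a → p a ≡ true →
    ∃[ b ] (a ≢ b × p a ≡ true × p b ≡ true × (∀ j → p j ≡ true → j ≡ a ⊎ j ≡ b))
  second a pa with b , wb , onlyB ← count≡1 (without a p) (cong pred (trans (sym (count-without-true p pa)) c)) =
    b , a≢b , pa , without-⊆ {p = p} b wb , cover
    where
    a≢b : a ≢ b
    a≢b refl = contradiction (trans (sym wb) (without-self p a)) λ ()
    cover : ∀ j → p j ≡ true → j ≡ a ⊎ j ≡ b
    cover j pj with j ≟ a
    ... | yes j≡a = inj₁ j≡a
    ... | no  j≢a = inj₂ (onlyB j (trans (without-other p j≢a) pj))

count-pair : ∀ {n} (p : Fin n → Bool) {a b} → a ≢ b → p a ≡ true → p b ≡ true →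
  (∀ j → p j ≡ true → j ≡ a ⊎ j ≡ b) → count p ≡ 2
count-pair p {a} {b} a≢b pa pb cover =
  trans (count-without-true p pa) (cong suc (count-single (without a p) (trans (without-other p (a≢b ∘ sym)) pb) onlyB))
  where
  onlyB : ∀ j → without a p j ≡ true → j ≡ b
  onlyB j wj with j ≟ a
  ... | yes _ = contradiction wj λ ()
  ... | no j≢a with cover j wj
  ...   | inj₁ j≡a = contradiction j≡a j≢a
  ...   | inj₂ j≡b = j≡b

length-filterᵇ-tabulate : ∀ {A : Set} {n} (p : A → Bool) (f : Fin n → A) →
  length (filterᵇ p (tabulate f)) ≡ count (p ∘ f)
length-filterᵇ-tabulate {n = zero}  p f = refl
length-filterᵇ-tabulate {n = suc n} p f with p (f zero)
... | true  = cong suc (length-filterᵇ-tabulate p (f ∘ suc))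
... | false = length-filterᵇ-tabulate p (f ∘ suc)

length-filterᵇ-++ : ∀ {A : Set} (p : A → Bool) (xs ys : List A) →
  length (filterᵇ p (xs ++ ys)) ≡ length (filterᵇ p xs) + length (filterᵇ p ys)
length-filterᵇ-++ p xs ys = trans (cong length (filter-++ (T? ∘ p) xs ys)) (length-++ (filterᵇ p xs))

length-filterᵇ-allFin : ∀ {A : Set} {n} (p : A → Bool) (f : Fin n → A) →
  length (filterᵇ p (map f (allFin n))) ≡ count (p ∘ f)
length-filterᵇ-allFin {n = n} p f =
  trans (cong (length ∘ filterᵇ p) (map-tabulate (λ i → i) f)) (length-filterᵇ-tabulate p f)

length-filterᵇ-allMV : ∀ {n} (p : MV n → Bool) →
  length (filterᵇ p (allMV n)) ≡ count (p ∘ vtx) + (count (p ∘ shadow) + toℕ (p w))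
length-filterᵇ-allMV {n} p = begin
  length (filterᵇ p (allMV n))
    ≡⟨ length-filterᵇ-++ p (map vtx (allFin n)) _ ⟩
  length (filterᵇ p (map vtx (allFin n))) + length (filterᵇ p (map shadow (allFin n) ++ w ∷ []))
    ≡⟨ cong₂ _+_ (length-filterᵇ-allFin p vtx) (length-filterᵇ-++ p (map shadow (allFin n)) _) ⟩
  count (p ∘ vtx) + (length (filterᵇ p (map shadow (allFin n))) + length (filterᵇ p (w ∷ [])))
    ≡⟨ cong (count (p ∘ vtx) +_) (cong₂ _+_ (length-filterᵇ-allFin p shadow) singleton) ⟩
  count (p ∘ vtx) + (count (p ∘ shadow) + toℕ (p w)) ∎
  where
  open ≡-Reasoning
  singleton : length (filterᵇ p (w ∷ [])) ≡ toℕ (p w)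
  singleton with p w
  ... | true  = refl
  ... | false = refl

closedNbhd≡not-muAdj : ∀ {n} (G : Graph n) x y → closedNbhd G x y ≡ not (muAdj G x y)
closedNbhd≡not-muAdj G (vtx i) (vtx j) with i ≟ j
... | yes refl rewrite irrefl G i = refl
... | no  _    = refl
closedNbhd≡not-muAdj G (shadow i) (shadow j) with i ≟ j
... | yes _ = refl
... | no  _ = refl
closedNbhd≡not-muAdj G (vtx _)    (shadow _) = refl
closedNbhd≡not-muAdj G (vtx _)    w          = refl
closedNbhd≡not-muAdj G (shadow _) (vtx _)    = refl
closedNbhd≡not-muAdj G (shadow _) w          = refl
closedNbhd≡not-muAdj G w          (vtx _)    = refl
closedNbhd≡not-muAdj G w          (shadow _) = refl
closedNbhd≡not-muAdj G w          w          = refl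

nonNbrs : ∀ {n} → Graph n → Fin n → (Fin n → Bool) → Fin n → Bool
nonNbrs G i p j = not (adj G i j) ∧ p j

nbrs : ∀ {n} → Graph n → Fin n → (Fin n → Bool) → Fin n → Bool
nbrs G i p j = adj G i j ∧ p j

nonNbrs-≗ : ∀ {n} (G : Graph n) {i} {p : Fin n → Bool} →
  (∀ j → p j ≡ true → adj G i j ≡ false) → ∀ j → nonNbrs G i p j ≡ p j
nonNbrs-≗ G {i} {p} far j with p j in pj
... | false = ∧-zeroʳ _
... | true  rewrite far j pj = refl

module _ {n} (G : Graph n) (D : MV n → Bool) where

  nbhdCount≡ : ∀ x → nbhdCount G D x ≡
    count (λ j → not (muAdj G x (vtx j)) ∧ D (vtx j))
      + (count (λ j → not (muAdj G x (shadow j)) ∧ D (shadow j)) + toℕ (not (muAdj G x w) ∧ D w))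
  nbhdCount≡ x = trans (length-filterᵇ-allMV (λ y → closedNbhd G x y ∧ D y))
    (cong₂ _+_ (count-cong (λ j → cong (_∧ D (vtx j)) (closedNbhd≡not-muAdj G x (vtx j))))
      (cong₂ _+_ (count-cong (λ j → cong (_∧ D (shadow j)) (closedNbhd≡not-muAdj G x (shadow j))))
        (cong (λ b → toℕ (b ∧ D w)) (closedNbhd≡not-muAdj G x w))))

  nbhdCount-w : nbhdCount G D w ≡ count (D ∘ vtx) + toℕ (D w)
  nbhdCount-w = trans (nbhdCount≡ w) (cong (λ k → count (D ∘ vtx) + (k + toℕ (D w))) (count-none {p = λ (_ : Fin n) → false} (λ _ → refl)))

  nbhdCount-shadow : ∀ i → nbhdCount G D (shadow i) ≡ count (nonNbrs G i (D ∘ vtx)) + count (D ∘ shadow)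
  nbhdCount-shadow i = trans (nbhdCount≡ (shadow i))
    (cong₂ _+_ (count-cong (λ j → cong (λ b → not b ∧ D (vtx j)) (adj-sym G j i))) (+-identityʳ _))

  nbhdCount-vtx : ∀ i → nbhdCount G D (vtx i) ≡
    count (nonNbrs G i (D ∘ vtx)) + (count (nonNbrs G i (D ∘ shadow)) + toℕ (D w))
  nbhdCount-vtx i = nbhdCount≡ (vtx i)

nonNbrs-⊆ : ∀ {n} (G : Graph n) {i} {p : Fin n → Bool} → nonNbrs G i p ⊆ p
nonNbrs-⊆ G {i} {p} j e = proj₂ (∧-true⁻ {not (adj G i j)} e)

nonNbrs-self : ∀ {n} (G : Graph n) {i} {p : Fin n → Bool} → p i ≡ true → nonNbrs G i p i ≡ true
nonNbrs-self G {i} pi rewrite irrefl G i = pi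

module _ {n} {G : Graph n} {D : MV n → Bool} (edd : IsEDDComplMu G D) where

  private
    V U : Fin n → Bool
    V = D ∘ vtx
    U = D ∘ shadow

    count-w : count V + toℕ (D w) ≡ 2
    count-w = trans (sym (nbhdCount-w G D)) (edd w)

    count-shadow : ∀ i → count (nonNbrs G i V) + count U ≡ 2
    count-shadow i = trans (sym (nbhdCount-shadow G D i)) (edd (shadow i))

    count-vtx : ∀ i → count (nonNbrs G i V) + (count (nonNbrs G i U) + toℕ (D w)) ≡ 2
    count-vtx i = trans (sym (nbhdCount-vtx G D i)) (edd (vtx i))

    overfull : ∀ a b → 3 ≤ a + b → a + b ≢ 2
    overfull _ _ 3≤a+b a+b≡2 = 1+n≰n (subst (3 ≤_) a+b≡2 3≤a+b)

    count-nbrs-shadows : ∀ i → count (nbrs G i U) ≡ toℕ (D w)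
    count-nbrs-shadows i = +-cancelʳ-≡ B A d (trans (+-cancelˡ-≡ X (A + B) (B + d) same) (+-comm B d))
      where
      X = count (nonNbrs G i V)
      A = count (nbrs G i U)
      B = count (nonNbrs G i U)
      d = toℕ (D w)
      same : X + (A + B) ≡ X + (B + d)
      same = trans (trans (cong (X +_) (sym (count-split (adj G i) U))) (count-shadow i)) (sym (count-vtx i))

    clash : ∀ {a b} → count V ≡ 1 → V a ≡ true → adj G a b ≡ true → ⊥
    clash {a} {b} V≡1 Va adj-ab =
      overfull (count (nonNbrs G a V)) (count U) (+-mono-≤ a-sees-a (≤-reflexive (sym U≡2))) (count-shadow a)
      where
      a-sees-a : 1 ≤ count (nonNbrs G a V)
      a-sees-a = count-pos (nonNbrs G a V) (nonNbrs-self G {p = V} Va)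
      b-sees-nothing : count (nonNbrs G b V) ≡ 0
      b-sees-nothing = n<1⇒n≡0 (subst (count (nonNbrs G b V) <_) V≡1
        (count-< (nonNbrs-⊆ G) (cong (λ x → not x ∧ V a) (trans (adj-sym G b a) adj-ab)) Va))
      U≡2 : count U ≡ 2
      U≡2 = subst (λ k → k + count U ≡ 2) b-sees-nothing (count-shadow b)

    Dw≢true : D w ≢ true
    Dw≢true dw =
      let V≡1 : count V ≡ 1
          V≡1 = +-cancelʳ-≡ 1 (count V) 1 (subst (λ x → count V + toℕ x ≡ 2) dw count-w)
          (a , Va) = count-witness {p = V} (subst (0 <_) (sym V≡1) (s≤s z≤n))
          nbrs-a≡1 = trans (count-nbrs-shadows a) (cong toℕ dw)
          (b , ab∧Ub) = count-witness {p = nbrs G a U} (subst (0 <_) (sym nbrs-a≡1) (s≤s z≤n))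
      in clash V≡1 Va (proj₁ (∧-true⁻ {adj G a b} ab∧Ub))

    Dw≡false : D w ≡ false
    Dw≡false = ¬-not Dw≢true

    V≡2 : count V ≡ 2
    V≡2 = trans (sym (+-identityʳ (count V))) (subst (λ x → count V + toℕ x ≡ 2) Dw≡false count-w)

    shadow∈D-isolated : ∀ c → U c ≡ true → Isolated G c
    shadow∈D-isolated c Uc i = trans (adj-sym G c i)
      (∧-falseˡ (count≡0⇒false (nbrs G i U) (trans (count-nbrs-shadows i) (cong toℕ Dw≡false)) c) Uc)

    shadows∉D : ∀ c → U c ≡ false
    shadows∉D c = ¬-not λ Uc →
      overfull (count (nonNbrs G c V)) (count U)
        (+-mono-≤ (≤-reflexive (sym (trans (count-cong (nonNbrs-≗ G λ j _ → shadow∈D-isolated c Uc j)) V≡2)))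
                  (count-pos U Uc))
        (count-shadow c)

    vtx∈D-isolated : ∀ j → V j ≡ true → Isolated G j
    vtx∈D-isolated j Vj i = trans (adj-sym G j i) (¬-not λ adj-ij →
      <-irrefl sees-all (count-< (nonNbrs-⊆ G) (cong (λ x → not x ∧ V j) adj-ij) Vj))
      where
      sees-all : count (nonNbrs G i V) ≡ count V
      sees-all = trans (sym (+-identityʳ _))
        (trans (subst (λ k → count (nonNbrs G i V) + k ≡ 2) (count-none shadows∉D) (count-shadow i)) (sym V≡2))

  eddComplMu⇒twoIsolated : TwoIsolated G D
  eddComplMu⇒twoIsolated = fromPair (count≡2 V V≡2)
    where
    fromPair : ∃[ a ] ∃[ b ] (a ≢ b × V a ≡ true × V b ≡ true × (∀ j → V j ≡ true → j ≡ a ⊎ j ≡ b)) →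
      TwoIsolated G D
    fromPair (a , b , a≢b , Va , Vb , cover) =
      a , b , a≢b , vtx∈D-isolated a Va , vtx∈D-isolated b Vb , members
      where
      members : ∀ x → (D x ≡ true) ⇔ (x ≡ vtx a ⊎ x ≡ vtx b)
      members (vtx j)    = mk⇔ (Data.Sum.map (cong vtx) (cong vtx) ∘ cover j)
                               λ { (inj₁ refl) → Va ; (inj₂ refl) → Vb }
      members (shadow j) = mk⇔ (λ Uj → contradiction (shadows∉D j) (not-¬ Uj)) λ { (inj₁ ()) ; (inj₂ ()) }
      members w          = mk⇔ (λ Dw → contradiction Dw≡false (not-¬ Dw)) λ { (inj₁ ()) ; (inj₂ ()) }

vtx-injective : ∀ {n} {i j : Fin n} → vtx i ≡ vtx j → i ≡ j
vtx-injective refl = refl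

twoIsolated⇒eddComplMu : ∀ {n} {G : Graph n} {D : MV n → Bool} → TwoIsolated G D → IsEDDComplMu G D
twoIsolated⇒eddComplMu {G = G} {D} (a , b , a≢b , iso-a , iso-b , members) = edd
  where
  open Equivalence
  V U : _ → Bool
  V = D ∘ vtx
  U = D ∘ shadow

  cover : ∀ j → V j ≡ true → j ≡ a ⊎ j ≡ b
  cover j = Data.Sum.map vtx-injective vtx-injective ∘ to (members (vtx j))

  shadows∉D : ∀ j → U j ≡ false
  shadows∉D j = ¬-not λ Uj → [ (λ ()) , (λ ()) ] (to (members (shadow j)) Uj)

  w∉D : D w ≡ false
  w∉D = ¬-not λ Dw → [ (λ ()) , (λ ()) ] (to (members w) Dw)

  V≡2 : count V ≡ 2
  V≡2 = count-pair V a≢b (from (members (vtx a)) (inj₁ refl)) (from (members (vtx b)) (inj₂ refl)) cover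

  vtx∈D-isolated : ∀ j → V j ≡ true → Isolated G j
  vtx∈D-isolated j Vj with cover j Vj
  ... | inj₁ refl = iso-a
  ... | inj₂ refl = iso-b

  sees-all : ∀ i → count (nonNbrs G i V) ≡ 2
  sees-all i = trans (count-cong (nonNbrs-≗ G λ j Vj → trans (adj-sym G i j) (vtx∈D-isolated j Vj i))) V≡2

  sees-no-shadow : ∀ i → count (nonNbrs G i U) ≡ 0
  sees-no-shadow i = count-none λ j → trans (cong (not (adj G i j) ∧_) (shadows∉D j)) (∧-zeroʳ _)

  edd : IsEDDComplMu G D
  edd w          = trans (nbhdCount-w G D) (cong₂ _+_ V≡2 (cong toℕ w∉D))
  edd (shadow i) = trans (nbhdCount-shadow G D i) (cong₂ _+_ (sees-all i) (count-none shadows∉D))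
  edd (vtx i)    = trans (nbhdCount-vtx G D i) (cong₂ _+_ (sees-all i) (cong₂ _+_ (sees-no-shadow i) (cong toℕ w∉D)))

pairSet : ∀ {n} → Fin n → Fin n → MV n → Bool
pairSet a b (vtx j) = does (j ≟ a ⊎-dec j ≟ b)
pairSet a b _       = false

pairSet-members : ∀ {n} (a b : Fin n) x → (pairSet a b x ≡ true) ⇔ (x ≡ vtx a ⊎ x ≡ vtx b)
pairSet-members a b (vtx j) = mk⇔
  (Data.Sum.map (cong vtx) (cong vtx) ∘ Equivalence.to (does≡true⇔ (j ≟ a ⊎-dec j ≟ b)))
  (Equivalence.from (does≡true⇔ (j ≟ a ⊎-dec j ≟ b)) ∘ Data.Sum.map vtx-injective vtx-injective)
pairSet-members a b (shadow _) = mk⇔ (λ ()) λ { (inj₁ ()) ; (inj₂ ()) }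
pairSet-members a b w          = mk⇔ (λ ()) λ { (inj₁ ()) ; (inj₂ ()) }

mainTheorem5 : ∀ {n} (G : Graph n) →
    (∀ (D : MV n → Bool) → IsEDDComplMu G D ⇔ TwoIsolated G D)
    × ((∃[ D ] IsEDDComplMu G D) ⇔
       (∃[ i ] ∃[ j ] (¬ i ≡ j × Isolated G i × Isolated G j)))
mainTheorem5 G =
  (λ D → mk⇔ eddComplMu⇒twoIsolated twoIsolated⇒eddComplMu) ,
  mk⇔ (λ (D , edd) → isolatedPair (eddComplMu⇒twoIsolated edd))
      (λ (a , b , a≢b , iso-a , iso-b) →
        pairSet a b , twoIsolated⇒eddComplMu (a , b , a≢b , iso-a , iso-b , pairSet-members a b))
  where
  isolatedPair : ∀ {D} → TwoIsolated G D → ∃[ i ] ∃[ j ] (¬ i ≡ j × Isolated G i × Isolated G j)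
  isolatedPair (a , b , a≢b , iso-a , iso-b , _) = a , b , a≢b , iso-a , iso-b
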